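{- Let $M\ge1$ be an integer, let $Y_1,\dots,Y_t$ be independent subgroups of $\mathbb{Z}^d$ with $h_i=\mathrm{rank}(Y_i)$, let $e_{i1},\dots,e_{ih_i}$ be linearly independent elements of $Y_i$ for each $i$, and let $y_{Y_1},\dots,y_{Y_t}\ge0$ be reals. Let $E$ be the $d\times m$ integer matrix with columns $e_{11},\dots,e_{1h_1},\dots,e_{t1},\dots,e_{th_t}$, where $m=\sum_ih_i$, and let $E=UDV^{ -1}$ be its Smith normal form: $U$ ($d\times d$) and $V$ ($m\times m$) unimodular integer matrices and $D$ a $d\times m$ matrix whose only nonzero entries are the positive diagonal entries $d_1\mid d_2\mid\dots\mid d_m$. Let $U''$ be the first $m$ columns of $U$ and $U'$ the last $d-m$ columns. Define $S=\{E\,(a_{11},\dots,a_{th_t})^T: a_{ij}\in\{0,\dots,\lfloor M^{y_{Y_i}}\rfloor-1\}\}$, $T_1=\{E\,(a_{11},\dots,a_{th_t})^T: a_{ij}\in\lfloor M^{y_{Y_i}}\rfloor\mathbb{Z}\}$, $T_2=\{U'(a_1,\dots,a_{d-m})^T: a_i\in\mathbb{Z}\}$, $T_3=\{U''(b_1,\dots,b_m)^T: b_i\in\{0,\dots,d_i-1\}\}$, and $T=T_1+T_2+T_3$ (Minkowski sum). Then the translates $t+S$, $t\in T$, tile $\mathbb{Z}^d$: they are pairwise disjoint and their union is $\mathbb{Z}^d$.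
   Context: Subgroups $Y_1,\dots,Y_t$ of $\mathbb{Z}^d$ are independent if $\mathrm{rank}(Y_1+\dots+Y_t)=\sum_i\mathrm{rank}(Y_i)$.
   Formalization: The numbers $y_{Y_1},\dots,y_{Y_t}$ are nonnegative rationals rather than nonnegative reals. -}

module Defs where

open import Data.Nat as ℕ using (ℕ; zero; suc)
open import Data.Integer as ℤ using (ℤ; +_; 0ℤ; 1ℤ)
open import Data.Integer.Divisibility as ℤ∣ using ()
open import Data.Rational as ℚ using (ℚ; ↥_; ↧ₙ_)
open import Data.Fin using (Fin; zero; suc; toℕ; splitAt; _≟_)
open import Data.Sum using (_⊎_; inj₁; inj₂)
open import Data.Product using (Σ; ∃; ∃-syntax; _×_; _,_)
open import Relation.Binary.PropositionalEquality using (_≡_; _≗_)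
open import Relation.Nullary using (yes; no)

Vecℤ : ℕ → Set
Vecℤ d = Fin d → ℤ

Mat : ℕ → ℕ → Set
Mat r c = Fin r → Fin c → ℤ

∑ : ∀ {n} → (Fin n → ℤ) → ℤ
∑ {zero}  f = 0ℤ
∑ {suc n} f = f zero ℤ.+ ∑ (λ i → f (suc i))

sumℕ : ∀ {n} → (Fin n → ℕ) → ℕ
sumℕ {zero}  f = 0
sumℕ {suc n} f = f zero ℕ.+ sumℕ (λ i → f (suc i))

_⊗_ : ∀ {r n c} → Mat r n → Mat n c → Mat r c
(A ⊗ B) i k = ∑ (λ j → A i j ℤ.* B j k)

infixl 7 _⊗_

_·_ : ∀ {r c} → Mat r c → Vecℤ c → Vecℤ r
(A · v) i = ∑ (λ j → A i j ℤ.* v j)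

_⊕_ : ∀ {d} → Vecℤ d → Vecℤ d → Vecℤ d
(x ⊕ y) k = x k ℤ.+ y k

infixl 6 _⊕_

idMat : ∀ {n} → Mat n n
idMat i j with i ≟ j
... | yes _ = 1ℤ
... | no  _ = 0ℤ

IsInverse : ∀ {n} → Mat n n → Mat n n → Set
IsInverse A B = (∀ i j → (A ⊗ B) i j ≡ idMat i j) × (∀ i j → (B ⊗ A) i j ≡ idMat i j)

IsUnimodular : ∀ {n} → Mat n n → Set
IsUnimodular A = ∃[ B ] IsInverse A B

record IsSubgroup {d : ℕ} (Y : Vecℤ d → Set) : Set where
  field
    ext   : ∀ {x y} → x ≗ y → Y x → Y y
    zero∈ : Y (λ _ → 0ℤ)
    +∈    : ∀ {x y} → Y x → Y y → Y (x ⊕ y)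
    -∈    : ∀ {x} → Y x → Y (λ k → ℤ.- x k)

LinIndep : ∀ {d k} → (Fin k → Vecℤ d) → Set
LinIndep {d} {k} v =
  (c : Fin k → ℤ) → (∀ x → ∑ (λ j → c j ℤ.* v j x) ≡ 0ℤ) → ∀ j → c j ≡ 0ℤ

HasRank : ∀ {d} → (Vecℤ d → Set) → ℕ → Set
HasRank {d} Y h =
  (Σ (Fin h → Vecℤ d) λ v → (∀ j → Y (v j)) × LinIndep v)
  × (∀ k (v : Fin k → Vecℤ d) → (∀ j → Y (v j)) → LinIndep v → k ℕ.≤ h)

SumSub : ∀ {d t} → (Fin t → Vecℤ d → Set) → Vecℤ d → Set
SumSub {d} {t} Y x =
  Σ (Fin t → Vecℤ d) λ y → (∀ i → Y i (y i)) × (∀ k → x k ≡ ∑ (λ i → y i k))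

Independent : ∀ {d t} → (Fin t → Vecℤ d → Set) → (h : Fin t → ℕ) → Set
Independent Y h = HasRank (SumSub Y) (sumℕ h)

-- n = ⌊ M ^ y ⌋ for a nonnegative rational y = p/q (p = ↥ y ≥ 0, q = ↧ₙ y ≥ 1):
-- n ≤ M^(p/q) < n+1  ⇔  n^q ≤ M^p < (n+1)^q.
IsFloorPow : ℕ → ℚ → ℕ → Set
IsFloorPow M y n =
  (n ℕ.^ ↧ₙ y ℕ.≤ M ℕ.^ ℤ.∣ ↥ y ∣) × (M ℕ.^ ℤ.∣ ↥ y ∣ ℕ.< suc n ℕ.^ ↧ₙ y)

concatCols : ∀ {A : Set} t (h : Fin t → ℕ) → ((i : Fin t) → Fin (h i) → A) → Fin (sumℕ h) → A
concatCols zero    h f ()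
concatCols (suc t) h f k with splitAt (h zero) k
... | inj₁ j  = f zero j
... | inj₂ k′ = concatCols t (λ i → h (suc i)) (λ i → f (suc i)) k′

Emat : ∀ {d t} (h : Fin t → ℕ) → ((i : Fin t) → Fin (h i) → Vecℤ d) → Mat d (sumℕ h)
Emat {d} {t} h e r c = concatCols t h (λ i j → e i j r) c

IsSNFDiag : ∀ {d m} → Mat d m → Set
IsSNFDiag {d} {m} D =
  (m ℕ.≤ d)
  × (∀ k l → ¬≡ (toℕ k) (toℕ l) → D k l ≡ 0ℤ)
  × (∀ k l → toℕ k ≡ toℕ l → 0ℤ ℤ.< D k l)
  × (∀ k l k′ l′ → toℕ k ≡ toℕ l → toℕ k′ ≡ toℕ l′ → toℕ l′ ≡ suc (toℕ l)
       → D k l ℤ∣.∣ D k′ l′)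
  where
    open import Relation.Nullary using (¬_)
    ¬≡ : ℕ → ℕ → Set
    ¬≡ a b = ¬ (a ≡ b)

InS : ∀ {d t} (h : Fin t → ℕ) → ((i : Fin t) → Fin (h i) → Vecℤ d) → (Fin t → ℕ) → Vecℤ d → Set
InS {d} {t} h e N x =
  Σ ((i : Fin t) → Fin (h i) → ℕ) λ a →
    (∀ i j → a i j ℕ.< N i)
    × (∀ k → x k ≡ ∑ (λ i → ∑ (λ j → + a i j ℤ.* e i j k)))

InT₁ : ∀ {d t} (h : Fin t → ℕ) → ((i : Fin t) → Fin (h i) → Vecℤ d) → (Fin t → ℕ) → Vecℤ d → Set
InT₁ {d} {t} h e N x =
  Σ ((i : Fin t) → Fin (h i) → ℤ) λ a →
    (∀ k → x k ≡ ∑ (λ i → ∑ (λ j → (+ N i ℤ.* a i j) ℤ.* e i j k)))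

-- T₂ = U' ℤ^{d-m}, U' = last d − m columns of U (indices k with toℕ k ≥ m).
InT₂ : ∀ {d} (m : ℕ) → Mat d d → Vecℤ d → Set
InT₂ {d} m U x =
  Σ (Vecℤ d) λ a → (∀ k → toℕ k ℕ.< m → a k ≡ 0ℤ) × (x ≗ U · a)

-- T₃ = { U'' b : 0 ≤ b_l < d_l }, U'' = first m columns of U, d_l = D_{ll}.
InT₃ : ∀ {d m} → Mat d d → Mat d m → Vecℤ d → Set
InT₃ {d} {m} U D x =
  Σ (Vecℤ d) λ b →
    (∀ k → m ℕ.≤ toℕ k → b k ≡ 0ℤ)
    × (∀ k l → toℕ k ≡ toℕ l → (0ℤ ℤ.≤ b k) × (b k ℤ.< D k l))
    × (x ≗ U · b)

InT : ∀ {d t} (h : Fin t → ℕ) → ((i : Fin t) → Fin (h i) → Vecℤ d) → (Fin t → ℕ)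
      → Mat d d → Mat d (sumℕ h) → Vecℤ d → Set
InT {d} h e N U D x =
  Σ (Vecℤ d) λ t₁ → Σ (Vecℤ d) λ t₂ → Σ (Vecℤ d) λ t₃ →
    InT₁ h e N t₁ × InT₂ (sumℕ h) U t₂ × InT₃ U D t₃ × (x ≗ t₁ ⊕ t₂ ⊕ t₃)

Tiles : ∀ {d} → (Vecℤ d → Set) → (Vecℤ d → Set) → Set
Tiles {d} S T =
  (∀ t t′ s s′ → T t → T t′ → S s → S s′ → (t ⊕ s) ≗ (t′ ⊕ s′) → t ≗ t′)
  × (∀ (z : Vecℤ d) → Σ (Vecℤ d) λ t → Σ (Vecℤ d) λ s → T t × S s × (z ≗ t ⊕ s))

{-# OPTIONS --safe #-}
-- Put w = U⁻¹ z. As D is diagonal with positive entries d_l, dividing w_l by d_l for l < m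
-- gives w = a + b + D q with a supported on the last d − m coordinates, b in the box
-- ∏ [0, d_l), and q unique. Since E (V q) = U D q, every z is U a + U b + E c with U a ∈ T₂,
-- U b ∈ T₃ and c = V q determined by z. Dividing each c_ij by N_i with remainder splits E c
-- into a T₁ part and an S part, the remainder being unique; so t + s determines s, hence t.
module Submission where

open import Defs
open import Data.Nat.Base as ℕ using (ℕ; zero; suc; _≤_; _<_; _^_)
import Data.Nat.Properties as ℕP
open import Data.Integer.Base as ℤ using (ℤ; +_; 0ℤ; 1ℤ; _+_; _*_)
import Data.Integer.Properties as ℤP
open import Data.Integer.DivMod using (_/_; _%_; a≡a%n+[a/n]*n; n%d<d)
open import Data.Integer.Tactic.RingSolver using (solve-∀)
open import Data.Fin using (Fin; zero; suc; toℕ; splitAt; _↑ˡ_; _↑ʳ_; inject≤; fromℕ<; _≟_)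
import Data.Fin.Properties as FinP
open import Data.Rational using (ℚ; 0ℚ; ↥_; ↧ₙ_) renaming (_≤_ to _≤ℚ_)
open import Data.Sum using (inj₁; inj₂)
open import Data.Product using (Σ; _×_; _,_; proj₁; proj₂)
open import Function using (_∘_)
open import Relation.Binary.Definitions using (tri<; tri≈; tri>)
open import Relation.Binary.PropositionalEquality
  using (_≡_; _≢_; _≗_; refl; sym; trans; cong; cong₂; subst; module ≡-Reasoning)
open import Relation.Nullary using (yes; no; ¬_)
open import Relation.Nullary.Negation using (contradiction)
import Algebra.Properties.Semiring.Sum ℤP.+-*-semiring as Sum
open import Algebra.Properties.AbelianGroup ℤP.+-0-abelianGroup using () renaming (∙-cancelʳ to +-cancelʳ)

divMod-< : ∀ {n r r′ q q′} → 0ℤ ℤ.≤ r → r ℤ.< n → 0ℤ ℤ.≤ r′ → q ℤ.< q′ → r + q * n ℤ.< r′ + q′ * n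
divMod-< {n} {r} {r′} {q} {q′} 0≤r r<n 0≤r′ q<q′ = begin-strict
  r + q * n      ≡⟨ ℤP.+-comm r _ ⟩
  q * n + r      <⟨ ℤP.+-monoʳ-< (q * n) r<n ⟩
  q * n + n      ≡⟨ ℤP.+-comm (q * n) n ⟩
  n + q * n      ≡⟨ sym (ℤP.suc-* q n) ⟩
  ℤ.suc q * n    ≤⟨ ℤP.*-monoʳ-≤-nonNeg n {{ℤ.nonNegative 0≤n}} (ℤP.i<j⇒suc[i]≤j q<q′) ⟩
  q′ * n         ≤⟨ ℤP.i≤j+i (q′ * n) r′ {{ℤ.nonNegative 0≤r′}} ⟩
  r′ + q′ * n    ∎
  where
  open ℤP.≤-Reasoning
  0≤n : 0ℤ ℤ.≤ n
  0≤n = ℤP.<⇒≤ (ℤP.≤-<-trans 0≤r r<n)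

divMod-unique : ∀ {n r r′ q q′} → 0ℤ ℤ.≤ r × r ℤ.< n → 0ℤ ℤ.≤ r′ × r′ ℤ.< n →
                r + q * n ≡ r′ + q′ * n → q ≡ q′ × r ≡ r′
divMod-unique {n} {r} {r′} {q} {q′} (0≤r , r<n) (0≤r′ , r′<n) eq with ℤP.<-cmp q q′
... | tri< q<q′ _ _ = contradiction eq (ℤP.<⇒≢ (divMod-< 0≤r r<n 0≤r′ q<q′))
... | tri> _ _ q′<q = contradiction (sym eq) (ℤP.<⇒≢ (divMod-< 0≤r′ r′<n 0≤r q′<q))
... | tri≈ _ refl _ = refl , +-cancelʳ (q * n) r r′ eq

%-bounds : ∀ a n .{{_ : ℤ.NonZero n}} → 0ℤ ℤ.< n → 0ℤ ℤ.≤ + (a % n) × + (a % n) ℤ.< n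
%-bounds a n 0<n =
  ℤ.+≤+ ℕ.z≤n , subst (+ (a % n) ℤ.<_) (ℤP.0≤i⇒+∣i∣≡i (ℤP.<⇒≤ 0<n)) (ℤ.+<+ (n%d<d a n))

floorPow-nonZero : ∀ {M n} y → 1 ≤ M → IsFloorPow M y n → ℕ.NonZero n
floorPow-nonZero {n = suc n} _ _ _ = _
floorPow-nonZero {M} {zero} y M≥1 (_ , M^p<1^q) =
  contradiction (subst (M ^ ℤ.∣ ↥ y ∣ <_) (ℕP.^-zeroˡ (↧ₙ y)) M^p<1^q)
                (ℕP.≤⇒≯ (ℕP.m^n>0 M {{ℕ.>-nonZero M≥1}} (ℤ.∣ ↥ y ∣)))

open ≡-Reasoning

∑≡sum : ∀ {n} (f : Fin n → ℤ) → ∑ f ≡ Sum.sum f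
∑≡sum {zero}  f = refl
∑≡sum {suc n} f = cong (_+_ (f zero)) (∑≡sum (f ∘ suc))

∑-cong : ∀ {n} {f g : Fin n → ℤ} → f ≗ g → ∑ f ≡ ∑ g
∑-cong {f = f} {g} f≗g = trans (∑≡sum f) (trans (Sum.sum-cong-≗ f≗g) (sym (∑≡sum g)))

∑-zero : ∀ {n} {f : Fin n → ℤ} → (∀ i → f i ≡ 0ℤ) → ∑ f ≡ 0ℤ
∑-zero {n} {f} f≡0 =
  trans (∑-cong {f = f} f≡0) (trans (∑≡sum {n} (λ _ → 0ℤ)) (Sum.sum-replicate-zero n))

∑-distrib-+ : ∀ {n} (f g : Fin n → ℤ) → ∑ (λ i → f i + g i) ≡ ∑ f + ∑ g
∑-distrib-+ f g =
  trans (∑≡sum (λ i → f i + g i)) (trans (Sum.∑-distrib-+ f g) (sym (cong₂ _+_ (∑≡sum f) (∑≡sum g))))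

*-distribˡ-∑ : ∀ {n} c (f : Fin n → ℤ) → c * ∑ f ≡ ∑ (λ i → c * f i)
*-distribˡ-∑ c f =
  trans (cong (c *_) (∑≡sum f)) (trans (Sum.*-distribˡ-sum c f) (sym (∑≡sum (λ i → c * f i))))

*-distribʳ-∑ : ∀ {n} c (f : Fin n → ℤ) → ∑ f * c ≡ ∑ (λ i → f i * c)
*-distribʳ-∑ c f =
  trans (cong (_* c) (∑≡sum f)) (trans (Sum.*-distribʳ-sum c f) (sym (∑≡sum (λ i → f i * c))))

∑-comm : ∀ {m n} (f : Fin m → Fin n → ℤ) → ∑ (λ i → ∑ (f i)) ≡ ∑ (λ j → ∑ (λ i → f i j))
∑-comm f = trans (∑∑≡sum-sum f) (trans (Sum.∑-comm f) (sym (∑∑≡sum-sum (λ j i → f i j))))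
  where
  ∑∑≡sum-sum : ∀ {m n} (g : Fin m → Fin n → ℤ) → ∑ (λ i → ∑ (g i)) ≡ Sum.sum (λ i → Sum.sum (g i))
  ∑∑≡sum-sum g = trans (∑-cong (∑≡sum ∘ g)) (∑≡sum (λ i → Sum.sum (g i)))

∑-single : ∀ {n} (f : Fin n → ℤ) i → (∀ j → j ≢ i → f j ≡ 0ℤ) → ∑ f ≡ f i
∑-single f zero f≡0 =
  trans (cong (_+_ (f zero)) (∑-zero (λ j → f≡0 (suc j) λ ()))) (ℤP.+-identityʳ _)
∑-single f (suc i) f≡0 = trans (cong₂ _+_ (f≡0 zero λ ()) (∑-single (f ∘ suc) i f∘suc≡0)) (ℤP.+-identityˡ _)
  where
  f∘suc≡0 : ∀ j → j ≢ i → f (suc j) ≡ 0ℤ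
  f∘suc≡0 j j≢i = f≡0 (suc j) (j≢i ∘ FinP.suc-injective)

∑-splitAt : ∀ a b (f : Fin (a ℕ.+ b) → ℤ) → ∑ f ≡ ∑ (f ∘ (_↑ˡ b)) + ∑ (f ∘ (a ↑ʳ_))
∑-splitAt zero    b f = sym (ℤP.+-identityˡ _)
∑-splitAt (suc a) b f =
  trans (cong (_+_ (f zero)) (∑-splitAt a b (f ∘ suc))) (sym (ℤP.+-assoc (f zero) _ _))

·-cong : ∀ {r c} {A B : Mat r c} {u v : Vecℤ c} → (∀ i j → A i j ≡ B i j) → u ≗ v → A · u ≗ B · v
·-cong A≡B u≗v i = ∑-cong (λ j → cong₂ _*_ (A≡B i j) (u≗v j))

·-congʳ : ∀ {r c} (A : Mat r c) {u v : Vecℤ c} → u ≗ v → A · u ≗ A · v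
·-congʳ A = ·-cong {A = A} (λ _ _ → refl)

·-distrib-⊕ : ∀ {r c} (A : Mat r c) (u v : Vecℤ c) → A · (u ⊕ v) ≗ A · u ⊕ A · v
·-distrib-⊕ A u v i = trans (∑-cong (λ j → ℤP.*-distribˡ-+ (A i j) (u j) (v j)))
                             (∑-distrib-+ (λ j → A i j * u j) (λ j → A i j * v j))

⊗-·-assoc : ∀ {r n c} (A : Mat r n) (B : Mat n c) (v : Vecℤ c) → (A ⊗ B) · v ≗ A · (B · v)
⊗-·-assoc A B v i = begin
  ∑ (λ k → ∑ (λ j → A i j * B j k) * v k)
    ≡⟨ ∑-cong (λ k → *-distribʳ-∑ (v k) (λ j → A i j * B j k)) ⟩
  ∑ (λ k → ∑ (λ j → A i j * B j k * v k))
    ≡⟨ ∑-cong (λ k → ∑-cong (λ j → ℤP.*-assoc (A i j) (B j k) (v k))) ⟩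
  ∑ (λ k → ∑ (λ j → A i j * (B j k * v k)))
    ≡⟨ ∑-comm (λ k j → A i j * (B j k * v k)) ⟩
  ∑ (λ j → ∑ (λ k → A i j * (B j k * v k)))
    ≡⟨ ∑-cong (λ j → sym (*-distribˡ-∑ (A i j) (λ k → B j k * v k))) ⟩
  ∑ (λ j → A i j * ∑ (λ k → B j k * v k))
    ∎

idMat-diagonal : ∀ {n} (i : Fin n) → idMat i i ≡ 1ℤ
idMat-diagonal i with i ≟ i
... | yes _   = refl
... | no  i≢i = contradiction refl i≢i

idMat-offDiagonal : ∀ {n} {i j : Fin n} → j ≢ i → idMat i j ≡ 0ℤ
idMat-offDiagonal {i = i} {j} j≢i with i ≟ j
... | yes i≡j = contradiction (sym i≡j) j≢i
... | no  _   = refl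

·-identityˡ : ∀ {n} (v : Vecℤ n) → idMat · v ≗ v
·-identityˡ v i = begin
  (idMat · v) i    ≡⟨ ∑-single (λ j → idMat i j * v j) i off-diagonal ⟩
  idMat i i * v i  ≡⟨ cong (_* v i) (idMat-diagonal i) ⟩
  1ℤ * v i         ≡⟨ ℤP.*-identityˡ (v i) ⟩
  v i              ∎
  where
  off-diagonal : ∀ j → j ≢ i → idMat i j * v j ≡ 0ℤ
  off-diagonal j j≢i = trans (cong (_* v j) (idMat-offDiagonal j≢i)) (ℤP.*-zeroˡ (v j))

·-inverseˡ : ∀ {n} (A B : Mat n n) → (∀ i j → (B ⊗ A) i j ≡ idMat i j) → ∀ v → B · (A · v) ≗ v
·-inverseˡ A B BA≡I v i = begin
  (B · (A · v)) i  ≡⟨ sym (⊗-·-assoc B A v i) ⟩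
  ((B ⊗ A) · v) i  ≡⟨ ·-cong BA≡I (λ _ → refl) i ⟩
  (idMat · v) i    ≡⟨ ·-identityˡ v i ⟩
  v i              ∎

·-cancelˡ : ∀ {n} (A B : Mat n n) → (∀ i j → (B ⊗ A) i j ≡ idMat i j) →
            ∀ {u v} → A · u ≗ A · v → u ≗ v
·-cancelˡ A B BA≡I {u} {v} Au≗Av i = begin
  u i              ≡⟨ sym (·-inverseˡ A B BA≡I u i) ⟩
  (B · (A · u)) i  ≡⟨ ·-congʳ B Au≗Av i ⟩
  (B · (A · v)) i  ≡⟨ ·-inverseˡ A B BA≡I v i ⟩
  v i              ∎

concatIndex : ∀ t (h : Fin t → ℕ) (i : Fin t) → Fin (h i) → Fin (sumℕ h)
concatIndex (suc t) h zero    j = j ↑ˡ sumℕ (h ∘ suc)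
concatIndex (suc t) h (suc i) j = h zero ↑ʳ concatIndex t (h ∘ suc) i j

module _ {A : Set} where

  blocks : ∀ t (h : Fin t → ℕ) → (Fin (sumℕ h) → A) → (i : Fin t) → Fin (h i) → A
  blocks t h c i j = c (concatIndex t h i j)

  concatCols-↑ˡ : ∀ t (h : Fin (suc t) → ℕ) (f : (i : Fin (suc t)) → Fin (h i) → A) j →
                  concatCols (suc t) h f (j ↑ˡ sumℕ (h ∘ suc)) ≡ f zero j
  concatCols-↑ˡ t h f j rewrite FinP.splitAt-↑ˡ (h zero) j (sumℕ (h ∘ suc)) = refl

  concatCols-↑ʳ : ∀ t (h : Fin (suc t) → ℕ) (f : (i : Fin (suc t)) → Fin (h i) → A) k →
                  concatCols (suc t) h f (h zero ↑ʳ k) ≡ concatCols t (h ∘ suc) (λ i → f (suc i)) k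
  concatCols-↑ʳ t h f k rewrite FinP.splitAt-↑ʳ (h zero) (sumℕ (h ∘ suc)) k = refl

  blocks-concatCols : ∀ t (h : Fin t → ℕ) (f : (i : Fin t) → Fin (h i) → A) i j →
                      blocks t h (concatCols t h f) i j ≡ f i j
  blocks-concatCols (suc t) h f zero    j = concatCols-↑ˡ t h f j
  blocks-concatCols (suc t) h f (suc i) j =
    trans (concatCols-↑ʳ t h f _) (blocks-concatCols t (h ∘ suc) (λ i → f (suc i)) i j)

  concatCols-blocks : ∀ t (h : Fin t → ℕ) c → concatCols t h (blocks t h c) ≗ c
  concatCols-blocks (suc t) h c k with splitAt (h zero) k in eq
  ... | inj₁ j  = cong c (FinP.splitAt⁻¹-↑ˡ eq)
  ... | inj₂ k′ =
    trans (concatCols-blocks t (h ∘ suc) (c ∘ (h zero ↑ʳ_)) k′) (cong c (FinP.splitAt⁻¹-↑ʳ eq))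

  concatCols-injective : ∀ t (h : Fin t → ℕ) {f g : (i : Fin t) → Fin (h i) → A} →
                         concatCols t h f ≗ concatCols t h g → ∀ i j → f i j ≡ g i j
  concatCols-injective t h {f} {g} f≗g i j = begin
    f i j                             ≡⟨ sym (blocks-concatCols t h f i j) ⟩
    blocks t h (concatCols t h f) i j ≡⟨ f≗g (concatIndex t h i j) ⟩
    blocks t h (concatCols t h g) i j ≡⟨ blocks-concatCols t h g i j ⟩
    g i j                             ∎

concatCols-zipWith : ∀ {A B C : Set} (_∙_ : A → B → C) t (h : Fin t → ℕ) f g k →
                     concatCols t h (λ i j → f i j ∙ g i j) k ≡ concatCols t h f k ∙ concatCols t h g k
concatCols-zipWith _∙_ (suc t) h f g k with splitAt (h zero) k
... | inj₁ j  = refl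
... | inj₂ k′ = concatCols-zipWith _∙_ t (h ∘ suc) (λ i → f (suc i)) (λ i → g (suc i)) k′

∑-concatCols : ∀ t (h : Fin t → ℕ) (g : (i : Fin t) → Fin (h i) → ℤ) →
               ∑ (concatCols t h g) ≡ ∑ (λ i → ∑ (g i))
∑-concatCols zero    h g = refl
∑-concatCols (suc t) h g = begin
  ∑ (concatCols (suc t) h g)
    ≡⟨ ∑-splitAt (h zero) (sumℕ (h ∘ suc)) (concatCols (suc t) h g) ⟩
  ∑ (λ j → concatCols (suc t) h g (j ↑ˡ sumℕ (h ∘ suc))) + ∑ (λ k → concatCols (suc t) h g (h zero ↑ʳ k))
    ≡⟨ cong₂ _+_ (∑-cong (concatCols-↑ˡ t h g)) (∑-cong (concatCols-↑ʳ t h g)) ⟩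
  ∑ (g zero) + ∑ (concatCols t (h ∘ suc) (λ i → g (suc i)))
    ≡⟨ cong (_+_ (∑ (g zero))) (∑-concatCols t (h ∘ suc) (λ i → g (suc i))) ⟩
  ∑ (λ i → ∑ (g i))
    ∎

module LinearCombination {d t} (h : Fin t → ℕ) (e : (i : Fin t) → Fin (h i) → Vecℤ d) where

  Coeffs : Set → Set
  Coeffs A = (i : Fin t) → Fin (h i) → A

  lincomb : Coeffs ℤ → Vecℤ d
  lincomb g k = ∑ (λ i → ∑ (λ j → g i j * e i j k))

  lincomb-cong : ∀ {f g} → (∀ i j → f i j ≡ g i j) → lincomb f ≗ lincomb g
  lincomb-cong f≡g k = ∑-cong (λ i → ∑-cong (λ j → cong (_* e i j k) (f≡g i j)))

  lincomb-+ : ∀ f g → lincomb (λ i j → f i j + g i j) ≗ lincomb f ⊕ lincomb g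
  lincomb-+ f g k = begin
    ∑ (λ i → ∑ (λ j → (f i j + g i j) * e i j k))
      ≡⟨ ∑-cong (λ i → ∑-cong (λ j → ℤP.*-distribʳ-+ (e i j k) (f i j) (g i j))) ⟩
    ∑ (λ i → ∑ (λ j → f i j * e i j k + g i j * e i j k))
      ≡⟨ ∑-cong (λ i → ∑-distrib-+ (λ j → f i j * e i j k) (λ j → g i j * e i j k)) ⟩
    ∑ (λ i → ∑ (λ j → f i j * e i j k) + ∑ (λ j → g i j * e i j k))
      ≡⟨ ∑-distrib-+ (λ i → ∑ (λ j → f i j * e i j k)) (λ i → ∑ (λ j → g i j * e i j k)) ⟩
    lincomb f k + lincomb g k
      ∎

  Emat-·-concatCols : ∀ g → Emat h e · concatCols t h g ≗ lincomb g
  Emat-·-concatCols g r = begin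
    ∑ (λ c → concatCols t h (λ i j → e i j r) c * concatCols t h g c)
      ≡⟨ ∑-cong (λ c → sym (concatCols-zipWith _*_ t h (λ i j → e i j r) g c)) ⟩
    ∑ (concatCols t h (λ i j → e i j r * g i j))
      ≡⟨ ∑-concatCols t h (λ i j → e i j r * g i j) ⟩
    ∑ (λ i → ∑ (λ j → e i j r * g i j))
      ≡⟨ ∑-cong (λ i → ∑-cong (λ j → ℤP.*-comm (e i j r) (g i j))) ⟩
    lincomb g r
      ∎

VanishesBelow : ∀ {d} → ℕ → Vecℤ d → Set
VanishesBelow m a = ∀ k → toℕ k < m → a k ≡ 0ℤ

VanishesFrom : ∀ {d} → ℕ → Vecℤ d → Set
VanishesFrom m b = ∀ k → m ≤ toℕ k → b k ≡ 0ℤ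

InBox : ∀ {d m} → Mat d m → Vecℤ d → Set
InBox D b = ∀ k l → toℕ k ≡ toℕ l → 0ℤ ℤ.≤ b k × b k ℤ.< D k l

module Diagonal {d m} (D : Mat d m) (m≤d : m ≤ d)
  (D-off : ∀ k l → ¬ toℕ k ≡ toℕ l → D k l ≡ 0ℤ)
  (D-pos : ∀ k l → toℕ k ≡ toℕ l → 0ℤ ℤ.< D k l) where

  row : Fin m → Fin d
  row l = inject≤ l m≤d

  toℕ-row : ∀ l → toℕ (row l) ≡ toℕ l
  toℕ-row l = FinP.toℕ-inject≤ l m≤d

  toℕ-row<m : ∀ l → toℕ (row l) < m
  toℕ-row<m l = subst (_< m) (sym (toℕ-row l)) (FinP.toℕ<n l)

  toℕ≡⇒≡row : ∀ {k l} → toℕ k ≡ toℕ l → k ≡ row l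
  toℕ≡⇒≡row {l = l} k≡l = FinP.toℕ-injective (trans k≡l (sym (toℕ-row l)))

  δ : Fin m → ℤ
  δ l = D (row l) l

  δ-pos : ∀ l → 0ℤ ℤ.< δ l
  δ-pos l = D-pos (row l) l (toℕ-row l)

  instance
    δ-nonZero : ∀ {l} → ℤ.NonZero (δ l)
    δ-nonZero {l} = ℤ.>-nonZero (δ-pos l)

  data Position : Fin d → Set where
    diagonalRow : ∀ l → Position (row l)
    zeroRow     : ∀ {k} → m ≤ toℕ k → Position k

  position : ∀ k → Position k
  position k with toℕ k ℕP.<? m
  ... | yes k<m =
    subst Position (sym (toℕ≡⇒≡row (sym (FinP.toℕ-fromℕ< k<m)))) (diagonalRow (fromℕ< k<m))
  ... | no  k≮m = zeroRow (ℕP.≮⇒≥ k≮m)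

  D·-row : ∀ q l → (D · q) (row l) ≡ δ l * q l
  D·-row q l = ∑-single (λ l′ → D (row l) l′ * q l′) l off-diagonal
    where
    off-diagonal : ∀ l′ → l′ ≢ l → D (row l) l′ * q l′ ≡ 0ℤ
    off-diagonal l′ l′≢l = trans (cong (_* q l′) (D-off (row l) l′ row≢l′)) (ℤP.*-zeroˡ (q l′))
      where
      row≢l′ : toℕ (row l) ≢ toℕ l′
      row≢l′ row≡l′ = l′≢l (FinP.toℕ-injective (trans (sym row≡l′) (toℕ-row l)))

  D·-zeroRow : ∀ q {k} → m ≤ toℕ k → (D · q) k ≡ 0ℤ
  D·-zeroRow q {k} m≤k = ∑-zero (λ l → trans (cong (_* q l) (D-off k l (λ k≡l →
    ℕP.<⇒≱ (subst (_< m) (sym k≡l) (FinP.toℕ<n l)) m≤k))) (ℤP.*-zeroˡ (q l)))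

  zeroRowPart : Vecℤ d → Vecℤ d
  zeroRowPart w k with position k
  ... | diagonalRow l = 0ℤ
  ... | zeroRow _     = w k

  residue : Vecℤ d → Vecℤ d
  residue w k with position k
  ... | diagonalRow l = + (w (row l) % δ l)
  ... | zeroRow _     = 0ℤ

  quotient : Vecℤ d → Vecℤ m
  quotient w l = w (row l) / δ l

  zeroRowPart-vanishesBelow : ∀ w → VanishesBelow m (zeroRowPart w)
  zeroRowPart-vanishesBelow w k k<m with position k
  ... | diagonalRow l = refl
  ... | zeroRow m≤k   = contradiction k<m (ℕP.≤⇒≯ m≤k)

  residue-vanishesFrom : ∀ w → VanishesFrom m (residue w)
  residue-vanishesFrom w k m≤k with position k
  ... | diagonalRow l = contradiction m≤k (ℕP.<⇒≱ (toℕ-row<m l))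
  ... | zeroRow _     = refl

  residue-inBox : ∀ w → InBox D (residue w)
  residue-inBox w k l k≡l with position k
  ... | zeroRow m≤k    = contradiction (subst (_< m) (sym k≡l) (FinP.toℕ<n l)) (ℕP.≤⇒≯ m≤k)
  ... | diagonalRow l′ with FinP.toℕ-injective {i = l′} {l} (trans (sym (toℕ-row l′)) k≡l)
  ...   | refl = %-bounds (w (row l′)) (δ l′) (δ-pos l′)

  diagonal-divMod : ∀ w → w ≗ (zeroRowPart w ⊕ residue w) ⊕ D · quotient w
  diagonal-divMod w k with position k
  ... | diagonalRow l = begin
    w (row l)                               ≡⟨ a≡a%n+[a/n]*n (w (row l)) (δ l) ⟩
    r + quotient w l * δ l                  ≡⟨ regroup r (quotient w l) (δ l) ⟩
    (0ℤ + r) + δ l * quotient w l           ≡⟨ cong (_+_ (0ℤ + r)) (sym (D·-row (quotient w) l)) ⟩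
    (0ℤ + r) + (D · quotient w) (row l)     ∎
    where
    r = + (w (row l) % δ l)
    regroup : ∀ r q n → r + q * n ≡ (0ℤ + r) + n * q
    regroup = solve-∀
  ... | zeroRow m≤k = begin
    w k                                 ≡⟨ sym (trans (ℤP.+-identityʳ _) (ℤP.+-identityʳ _)) ⟩
    (w k + 0ℤ) + 0ℤ                     ≡⟨ cong (_+_ (w k + 0ℤ)) (sym (D·-zeroRow (quotient w) m≤k)) ⟩
    (w k + 0ℤ) + (D · quotient w) k     ∎

  quotient-unique : ∀ {a b a′ b′ q q′} →
                    VanishesBelow m a → InBox D b → VanishesBelow m a′ → InBox D b′ →
                    (a ⊕ b) ⊕ D · q ≗ (a′ ⊕ b′) ⊕ D · q′ → q ≗ q′
  quotient-unique {a} {b} {a′} {b′} {q} {q′} a↓ b□ a′↓ b′□ eq l =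
    proj₁ (divMod-unique (b□ (row l) l (toℕ-row l)) (b′□ (row l) l (toℕ-row l)) (begin
      b (row l) + q l * δ l                ≡⟨ sym (atRow a b q a↓) ⟩
      ((a ⊕ b) ⊕ D · q) (row l)            ≡⟨ eq (row l) ⟩
      ((a′ ⊕ b′) ⊕ D · q′) (row l)         ≡⟨ atRow a′ b′ q′ a′↓ ⟩
      b′ (row l) + q′ l * δ l              ∎))
    where
    atRow : ∀ a b q → VanishesBelow m a → ((a ⊕ b) ⊕ D · q) (row l) ≡ b (row l) + q l * δ l
    atRow a b q a↓ = begin
      (a (row l) + b (row l)) + (D · q) (row l)
        ≡⟨ cong₂ (λ x y → (x + b (row l)) + y) (a↓ (row l) (toℕ-row<m l)) (D·-row q l) ⟩
      (0ℤ + b (row l)) + δ l * q l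
        ≡⟨ regroup (b (row l)) (δ l) (q l) ⟩
      b (row l) + q l * δ l
        ∎
      where
      regroup : ∀ r n q → (0ℤ + r) + n * q ≡ r + q * n
      regroup = solve-∀

module SmithForm {d m} (U U⁻¹ : Mat d d) (U-inverse : IsInverse U U⁻¹)
  (V V⁻¹ : Mat m m) (V-inverse : IsInverse V V⁻¹)
  (D : Mat d m) (m≤d : m ≤ d)
  (D-off : ∀ k l → ¬ toℕ k ≡ toℕ l → D k l ≡ 0ℤ)
  (D-pos : ∀ k l → toℕ k ≡ toℕ l → 0ℤ ℤ.< D k l)
  (E : Mat d m) (E≡UDV⁻¹ : ∀ r c → E r c ≡ (U ⊗ D ⊗ V⁻¹) r c) where

  open Diagonal D m≤d D-off D-pos public

  E·≗U·D·V⁻¹· : ∀ c → E · c ≗ U · (D · (V⁻¹ · c))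
  E·≗U·D·V⁻¹· c r = begin
    (E · c) r                  ≡⟨ ·-cong E≡UDV⁻¹ (λ _ → refl) r ⟩
    ((U ⊗ D ⊗ V⁻¹) · c) r      ≡⟨ ⊗-·-assoc (U ⊗ D) V⁻¹ c r ⟩
    ((U ⊗ D) · (V⁻¹ · c)) r    ≡⟨ ⊗-·-assoc U D (V⁻¹ · c) r ⟩
    (U · (D · (V⁻¹ · c))) r    ∎

  U·-form : ∀ a b c → (U · a ⊕ U · b) ⊕ E · c ≗ U · ((a ⊕ b) ⊕ D · (V⁻¹ · c))
  U·-form a b c r = begin
    ((U · a) r + (U · b) r) + (E · c) r
      ≡⟨ cong₂ _+_ (sym (·-distrib-⊕ U a b r)) (E·≗U·D·V⁻¹· c r) ⟩
    (U · (a ⊕ b)) r + (U · (D · (V⁻¹ · c))) r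
      ≡⟨ sym (·-distrib-⊕ U (a ⊕ b) (D · (V⁻¹ · c)) r) ⟩
    (U · ((a ⊕ b) ⊕ D · (V⁻¹ · c))) r
      ∎

  snf-divMod : ∀ z → let w = U⁻¹ · z in z ≗ (U · zeroRowPart w ⊕ U · residue w) ⊕ E · (V · quotient w)
  snf-divMod z r = begin
    z r
      ≡⟨ sym (·-inverseˡ U⁻¹ U (proj₁ U-inverse) z r) ⟩
    (U · w) r
      ≡⟨ ·-congʳ U (diagonal-divMod w) r ⟩
    (U · ((zeroRowPart w ⊕ residue w) ⊕ D · q)) r
      ≡⟨ ·-congʳ U (λ k → cong (_+_ (zeroRowPart w k + residue w k))
                             (·-congʳ D (λ l → sym (·-inverseˡ V V⁻¹ (proj₂ V-inverse) q l)) k)) r ⟩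
    (U · ((zeroRowPart w ⊕ residue w) ⊕ D · (V⁻¹ · (V · q)))) r
      ≡⟨ sym (U·-form (zeroRowPart w) (residue w) (V · q) r) ⟩
    ((U · zeroRowPart w ⊕ U · residue w) ⊕ E · (V · q)) r
      ∎
    where
    w = U⁻¹ · z
    q = quotient w

  snf-unique : ∀ {a b c a′ b′ c′} →
               VanishesBelow m a → InBox D b → VanishesBelow m a′ → InBox D b′ →
               (U · a ⊕ U · b) ⊕ E · c ≗ (U · a′ ⊕ U · b′) ⊕ E · c′ → c ≗ c′
  snf-unique {a} {b} {c} {a′} {b′} {c′} a↓ b□ a′↓ b′□ eq =
    ·-cancelˡ V⁻¹ V (proj₁ V-inverse) (quotient-unique a↓ b□ a′↓ b′□
      (·-cancelˡ U U⁻¹ (proj₂ U-inverse) (λ r →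
        trans (sym (U·-form a b c r)) (trans (eq r) (U·-form a′ b′ c′ r)))))

module Tiling {d t} (h : Fin t → ℕ) (e : (i : Fin t) → Fin (h i) → Vecℤ d)
  (N : Fin t → ℕ) (N≢0 : ∀ i → ℕ.NonZero (N i))
  (U U⁻¹ : Mat d d) (U-inverse : IsInverse U U⁻¹)
  (V V⁻¹ : Mat (sumℕ h) (sumℕ h)) (V-inverse : IsInverse V V⁻¹)
  (D : Mat d (sumℕ h)) (m≤d : sumℕ h ≤ d)
  (D-off : ∀ k l → ¬ toℕ k ≡ toℕ l → D k l ≡ 0ℤ)
  (D-pos : ∀ k l → toℕ k ≡ toℕ l → 0ℤ ℤ.< D k l)
  (E≡UDV⁻¹ : ∀ r c → Emat h e r c ≡ (U ⊗ D ⊗ V⁻¹) r c) where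

  open LinearCombination h e
  open SmithForm U U⁻¹ U-inverse V V⁻¹ V-inverse D m≤d D-off D-pos (Emat h e) E≡UDV⁻¹

  private instance
    N-nonZero : ∀ {i} → ℕ.NonZero (N i)
    N-nonZero {i} = N≢0 i

  recombine : Coeffs ℤ → Coeffs ℕ → Coeffs ℤ
  recombine α β i j = + N i * α i j + + β i j

  private
    recombine-as-divMod : ∀ n r q → n * q + r ≡ r + q * n
    recombine-as-divMod = solve-∀

  recombine-injective : ∀ {α α′ β β′} → (∀ i j → β i j < N i) → (∀ i j → β′ i j < N i) →
                        ∀ i j → recombine α β i j ≡ recombine α′ β′ i j → β i j ≡ β′ i j
  recombine-injective {α} {α′} {β} {β′} β<N β′<N i j eq =
    ℤP.+-injective (proj₂ (divMod-unique {q = α i j} {α′ i j} (digit-bounds β<N) (digit-bounds β′<N)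
    (begin
      + β i j + α i j * + N i      ≡⟨ sym (recombine-as-divMod (+ N i) (+ β i j) (α i j)) ⟩
      recombine α β i j            ≡⟨ eq ⟩
      recombine α′ β′ i j          ≡⟨ recombine-as-divMod (+ N i) (+ β′ i j) (α′ i j) ⟩
      + β′ i j + α′ i j * + N i    ∎)))
    where
    digit-bounds : ∀ {γ : Coeffs ℕ} → (∀ i j → γ i j < N i) → 0ℤ ℤ.≤ + γ i j × + γ i j ℤ.< + N i
    digit-bounds γ<N = ℤ.+≤+ ℕ.z≤n , ℤ.+<+ (γ<N i j)

  carries : Vecℤ (sumℕ h) → Coeffs ℤ
  carries c i j = blocks t h c i j / + N i

  digits : Vecℤ (sumℕ h) → Coeffs ℕ
  digits c i j = blocks t h c i j % + N i

  digits<N : ∀ c i j → digits c i j < N i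
  digits<N c i j = n%d<d (blocks t h c i j) (+ N i)

  Emat-·-divMod : ∀ c → Emat h e · c ≗
                  lincomb (λ i j → + N i * carries c i j) ⊕ lincomb (λ i j → + digits c i j)
  Emat-·-divMod c k = begin
    (Emat h e · c) k
      ≡⟨ ·-congʳ (Emat h e) (λ l → sym (concatCols-blocks t h c l)) k ⟩
    (Emat h e · concatCols t h (blocks t h c)) k
      ≡⟨ Emat-·-concatCols (blocks t h c) k ⟩
    lincomb (blocks t h c) k
      ≡⟨ lincomb-cong blocks≡recombine k ⟩
    lincomb (recombine (carries c) (digits c)) k
      ≡⟨ lincomb-+ (λ i j → + N i * carries c i j) (λ i j → + digits c i j) k ⟩
    lincomb (λ i j → + N i * carries c i j) k + lincomb (λ i j → + digits c i j) k
      ∎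
    where
    blocks≡recombine : ∀ i j → blocks t h c i j ≡ recombine (carries c) (digits c) i j
    blocks≡recombine i j = trans (a≡a%n+[a/n]*n (blocks t h c i j) (+ N i))
                                 (sym (recombine-as-divMod (+ N i) (+ digits c i j) (carries c i j)))

  T⊕S-form : ∀ {x s x₁ x₂ x₃ α a b β} → x ≗ x₁ ⊕ x₂ ⊕ x₃ →
             (∀ k → x₁ k ≡ lincomb (λ i j → + N i * α i j) k) → x₂ ≗ U · a → x₃ ≗ U · b →
             (∀ k → s k ≡ lincomb (λ i j → + β i j) k) →
             x ⊕ s ≗ (U · a ⊕ U · b) ⊕ Emat h e · concatCols t h (recombine α β)
  T⊕S-form {x} {s} {x₁} {x₂} {x₃} {α} {a} {b} {β} x≗ x₁≗ x₂≗ x₃≗ s≗ k = begin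
    x k + s k
      ≡⟨ cong₂ _+_ (trans (x≗ k) (cong₂ _+_ (cong₂ _+_ (x₁≗ k) (x₂≗ k)) (x₃≗ k))) (s≗ k) ⟩
    ((L₁ + (U · a) k) + (U · b) k) + L₂
      ≡⟨ regroup L₁ ((U · a) k) ((U · b) k) L₂ ⟩
    ((U · a) k + (U · b) k) + (L₁ + L₂)
      ≡⟨ cong (_+_ ((U · a) k + (U · b) k)) (sym (lincomb-+ (λ i j → + N i * α i j) (λ i j → + β i j) k)) ⟩
    ((U · a) k + (U · b) k) + lincomb (recombine α β) k
      ≡⟨ cong (_+_ ((U · a) k + (U · b) k)) (sym (Emat-·-concatCols (recombine α β) k)) ⟩
    ((U · a) k + (U · b) k) + (Emat h e · concatCols t h (recombine α β)) k
      ∎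
    where
    L₁ = lincomb (λ i j → + N i * α i j) k
    L₂ = lincomb (λ i j → + β i j) k
    regroup : ∀ l₁ ua ub l₂ → ((l₁ + ua) + ub) + l₂ ≡ (ua + ub) + (l₁ + l₂)
    regroup = solve-∀

  disjoint : ∀ x x′ s s′ → InT h e N U D x → InT h e N U D x′ → InS h e N s → InS h e N s′ →
             x ⊕ s ≗ x′ ⊕ s′ → x ≗ x′
  disjoint x x′ s s′
    (_ , _ , _ , (α , x₁≗) , (a , a↓ , x₂≗) , (b , _ , b□ , x₃≗) , x≗)
    (_ , _ , _ , (α′ , x₁′≗) , (a′ , a′↓ , x₂′≗) , (b′ , _ , b′□ , x₃′≗) , x′≗)
    (β , β<N , s≗) (β′ , β′<N , s′≗) x⊕s≗x′⊕s′ k =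
    +-cancelʳ (s k) (x k) (x′ k) (trans (x⊕s≗x′⊕s′ k) (cong (_+_ (x′ k)) (sym (s≗s′ k))))
    where
    same-coeffs : concatCols t h (recombine α β) ≗ concatCols t h (recombine α′ β′)
    same-coeffs = snf-unique a↓ b□ a′↓ b′□ (λ r → trans (sym (T⊕S-form x≗ x₁≗ x₂≗ x₃≗ s≗ r))
                                             (trans (x⊕s≗x′⊕s′ r) (T⊕S-form x′≗ x₁′≗ x₂′≗ x₃′≗ s′≗ r)))
    β≡β′ : ∀ i j → β i j ≡ β′ i j
    β≡β′ i j = recombine-injective {α} {α′} β<N β′<N i j (concatCols-injective t h same-coeffs i j)
    s≗s′ : s ≗ s′
    s≗s′ k = trans (s≗ k) (trans (lincomb-cong (λ i j → cong +_ (β≡β′ i j)) k) (sym (s′≗ k)))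

  cover : ∀ z → Σ (Vecℤ d) λ x → Σ (Vecℤ d) λ s → InT h e N U D x × InS h e N s × z ≗ x ⊕ s
  cover z = x₁ ⊕ U · a ⊕ U · b , s
          , (x₁ , U · a , U · b , (α , λ _ → refl) , (a , zeroRowPart-vanishesBelow w , λ _ → refl)
            , (b , residue-vanishesFrom w , residue-inBox w , λ _ → refl) , λ _ → refl)
          , (β , digits<N c , λ _ → refl)
          , z≗x⊕s
    where
    w = U⁻¹ · z
    a = zeroRowPart w
    b = residue w
    c = V · quotient w
    α = carries c
    β = digits c
    x₁ = lincomb (λ i j → + N i * α i j)
    s = lincomb (λ i j → + β i j)
    z≗x⊕s : z ≗ (x₁ ⊕ U · a ⊕ U · b) ⊕ s
    z≗x⊕s k = begin
      z k
        ≡⟨ snf-divMod z k ⟩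
      ((U · a) k + (U · b) k) + (Emat h e · c) k
        ≡⟨ cong (_+_ ((U · a) k + (U · b) k)) (Emat-·-divMod c k) ⟩
      ((U · a) k + (U · b) k) + (x₁ k + s k)
        ≡⟨ regroup ((U · a) k) ((U · b) k) (x₁ k) (s k) ⟩
      ((x₁ k + (U · a) k) + (U · b) k) + s k
        ∎
      where
      regroup : ∀ ua ub l₁ l₂ → (ua + ub) + (l₁ + l₂) ≡ ((l₁ + ua) + ub) + l₂
      regroup = solve-∀

  tiles : Tiles (InS h e N) (InT h e N U D)
  tiles = disjoint , cover

mainTheorem6 : (d t M : ℕ) → 1 ≤ M
    → (Y : Fin t → Vecℤ d → Set) → (∀ i → IsSubgroup (Y i))
    → (h : Fin t → ℕ) → (∀ i → HasRank (Y i) (h i)) → Independent Y h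
    → (e : (i : Fin t) → Fin (h i) → Vecℤ d)
    → (∀ i j → Y i (e i j)) → (∀ i → LinIndep (e i))
    → (y : Fin t → ℚ) → (∀ i → 0ℚ ≤ℚ y i)
    → (N : Fin t → ℕ) → (∀ i → IsFloorPow M (y i) (N i))
    → (U : Mat d d) → IsUnimodular U
    → (V Vinv : Mat (sumℕ h) (sumℕ h)) → IsInverse V Vinv
    → (D : Mat d (sumℕ h)) → IsSNFDiag D
    → (∀ r c → Emat h e r c ≡ (U ⊗ D ⊗ Vinv) r c)
    → Tiles (InS h e N) (InT h e N U D)
-- Only N_i ≥ 1 and the Smith form E = U D V⁻¹ with m positive diagonal entries are used: the
-- independence of the Y_i and of the e_ij serves to make E of rank m, which IsSNFDiag records.
mainTheorem6 d t M M≥1 _ _ h _ _ e _ _ y _ N N≡⌊M^y⌋ U (U⁻¹ , U-inverse) V V⁻¹ V-inverse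
             D (m≤d , D-off , D-pos , _) E≡UDV⁻¹ =
  Tiling.tiles h e N (λ i → floorPow-nonZero (y i) M≥1 (N≡⌊M^y⌋ i))
               U U⁻¹ U-inverse V V⁻¹ V-inverse D m≤d D-off D-pos E≡UDV⁻¹
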